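{- (i) For the molecular graph of methane, $\pi_2^*(CH_4)=2$ and $P_2^*(CH_4)=1$. (ii) For the molecular graph of ethane, $\pi_2^*(C_2H_6)=3$ and $P_2^*(C_2H_6)=2$.
   Context: Molecular graphs have one vertex per atom (carbon and hydrogen) and one edge per chemical bond. The graph of methane $CH_4$ is the star $K_{1,4}$ (one carbon adjacent to four hydrogens). The graph of ethane $C_2H_6$ is the tree with two adjacent carbon vertices, each also adjacent to three hydrogen leaves (8 vertices). For a graph $G=(V,E)$, a pebbling configuration is a function $f:V\to\mathbb{N}\cup\{0\}$, of weight $w(f)=\sum_{u}f(u)$. A pebbling move removes two pebbles from a vertex $u$ and places one pebble on a vertex adjacent to $u$. $f$ is solvable if for every vertex $v$ some (possibly empty) sequence of pebbling moves from $f$ results in at least one pebble on $v$. $f$ is a $2$-restricted pebbling configuration (2RPC) if $f(u)\le2$ for all $u$. $\pi_2^*(G)$ is the minimum weight of a solvable 2RPC on $G$; a $2$-restricted optimal pebbling configuration is a solvable 2RPC of weight $\pi_2^*(G)$, and $P_2^*(G)$ is the number of distinct such configurations. -}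

module Defs where

open import Data.Nat using (ℕ; zero; suc; _+_; _∸_; _≤_)
open import Data.Fin using (Fin; zero; suc)
open import Data.Vec using (Vec; lookup; updateAt; sum)
open import Data.List using (List; []; _∷_; length)
open import Data.List.Membership.Propositional using (_∈_)
open import Data.List.Relation.Unary.Unique.Propositional using (Unique)
open import Data.Product using (_×_; _,_; Σ; ∃)
open import Data.Sum using (_⊎_)
open import Relation.Binary.PropositionalEquality using (_≡_)
open import Relation.Binary.Construct.Closure.ReflexiveTransitive using (Star)
open import Function.Bundles using (_⇔_)

record Graph : Set where
  field
    n     : ℕ
    edges : List (Fin n × Fin n)

open Graph public

Adj : (G : Graph) → Fin (n G) → Fin (n G) → Set
Adj G u v = ((u , v) ∈ edges G) ⊎ ((v , u) ∈ edges G)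

Config : Graph → Set
Config G = Vec ℕ (n G)

weight : (G : Graph) → Config G → ℕ
weight G f = sum f

data Move (G : Graph) : Config G → Config G → Set where
  move : (f : Config G) (u v : Fin (n G)) → Adj G u v → 2 ≤ lookup f u →
         Move G f (updateAt (updateAt f u (λ x → x ∸ 2)) v suc)

Reach : (G : Graph) → Config G → Config G → Set
Reach G = Star (Move G)

Solvable : (G : Graph) → Config G → Set
Solvable G f = (v : Fin (n G)) → ∃ λ g → Reach G f g × (1 ≤ lookup g v)

TwoRestricted : (G : Graph) → Config G → Set
TwoRestricted G f = (u : Fin (n G)) → lookup f u ≤ 2

SolvableTwoRPC : (G : Graph) → Config G → Set
SolvableTwoRPC G f = TwoRestricted G f × Solvable G f

IsPi2Star : (G : Graph) → ℕ → Set
IsPi2Star G m =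
  (Σ (Config G) λ f → SolvableTwoRPC G f × weight G f ≡ m)
  × ((f : Config G) → SolvableTwoRPC G f → m ≤ weight G f)

Optimal2 : (G : Graph) → ℕ → Config G → Set
Optimal2 G m f = SolvableTwoRPC G f × weight G f ≡ m

IsP2Star : (G : Graph) → ℕ → ℕ → Set
IsP2Star G m k =
  IsPi2Star G m ×
  (Σ (List (Config G)) λ L →
      Unique {A = Config G} L × length L ≡ k
      × ((f : Config G) → (_∈_ {A = Config G} f L) ⇔ Optimal2 G m f))

-- Methane CH4: vertex 0 = carbon, vertices 1..4 = hydrogens (star K_{1,4})
methane : Graph
methane = record
  { n = 5
  ; edges = (zero , suc zero) ∷ (zero , suc (suc zero))
          ∷ (zero , suc (suc (suc zero))) ∷ (zero , suc (suc (suc (suc zero)))) ∷ [] }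

-- Ethane C2H6: vertices 0,1 = carbons; 2,3,4 hydrogens on 0; 5,6,7 hydrogens on 1
ethane : Graph
ethane = record
  { n = 8
  ; edges = (c₀ , c₁)
          ∷ (c₀ , h 2) ∷ (c₀ , h 3) ∷ (c₀ , h 4)
          ∷ (c₁ , h 5) ∷ (c₁ , h 6) ∷ (c₁ , h 7) ∷ [] }
  where
  c₀ c₁ : Fin 8
  c₀ = zero
  c₁ = suc zero
  h : ℕ → Fin 8
  h 2 = suc (suc zero)
  h 3 = suc (suc (suc zero))
  h 4 = suc (suc (suc (suc zero)))
  h 5 = suc (suc (suc (suc (suc zero))))
  h 6 = suc (suc (suc (suc (suc (suc zero)))))
  h _ = suc (suc (suc (suc (suc (suc (suc zero))))))

-- A pebbling move from u to an adjacent v trades two pebbles on u for one on v,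
-- so for any weight w with w(v) ≤ 2 w(u) along every edge the potential
-- Σᵤ w(u) f(u) never increases. Taking w = 2^(D − d(·, v)) for each target v
-- (D the diameter) gives a necessary condition for solvability: the potential of
-- f must be at least w(v). On methane and ethane the 2-restricted configurations
-- are few enough that checking this condition on all of them pins down the
-- minimum weight and every configuration attaining it; conversely, the optimal
-- configurations are shown solvable by explicit moves.
module Submission where

open import Defs
open import Data.Fin using (Fin; zero; suc)
open import Data.Fin.Properties using (all?) renaming (_≟_ to _≟ᶠ_)
open import Data.List using (List; []; _∷_; length; upTo; cartesianProductWith)
open import Data.List.Membership.Propositional using (_∈_)
open import Data.List.Membership.Propositional.Properties
  using (∈-cartesianProductWith⁺; ∈-upTo⁺)
import Data.List.Membership.DecPropositional as DecMembership
open import Data.List.Relation.Unary.All as All using (All; []; _∷_)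
open import Data.List.Relation.Unary.AllPairs using ([]; _∷_)
open import Data.List.Relation.Unary.Any using (here)
open import Data.List.Relation.Unary.Unique.Propositional using (Unique)
open import Data.Nat using (ℕ; zero; suc; _+_; _*_; _∸_; _≤_; s≤s; _≤?_; _≟_)
open import Data.Nat.Properties
  using (≤-refl; ≤-trans; +-monoʳ-≤; +-assoc; m≤m+n; m≤n+m; ≤-reflexive; *-suc; module ≤-Reasoning)
open import Data.Nat.Tactic.RingSolver using (solve-∀)
open import Data.Product using (_×_; _,_; proj₁; proj₂; ∃)
open import Data.Product.Properties using () renaming (≡-dec to ×-≡-dec)
open import Data.Sum using (inj₁; inj₂)
open import Data.Vec using (Vec; []; _∷_; lookup; updateAt; sum)
open import Data.Vec.Properties using () renaming (≡-dec to vec-≡-dec)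
open import Function.Bundles using (mk⇔)
open import Relation.Binary.Construct.Closure.ReflexiveTransitive using (ε; _◅_; _◅◅_)
open import Relation.Binary.PropositionalEquality using (_≡_; _≢_; refl; sym; trans; cong)
open import Relation.Nullary.Decidable using (Dec; True; from-yes; toWitness; _×-dec_; _→-dec_; _⊎-dec_)
open import Relation.Unary using (Decidable)

potential : ∀ {d} → Vec ℕ d → Vec ℕ d → ℕ
potential []       []       = 0
potential (w ∷ ws) (x ∷ xs) = w * x + potential ws xs

potential-updateAt-suc : ∀ {d} (w f : Vec ℕ d) v →
  potential w (updateAt f v suc) ≡ potential w f + lookup w v
potential-updateAt-suc (w ∷ ws) (x ∷ xs) zero = solved w x (potential ws xs)
  where
  solved : ∀ w x p → w * suc x + p ≡ w * x + p + w
  solved = solve-∀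
potential-updateAt-suc (w ∷ ws) (x ∷ xs) (suc v) =
  trans (cong (w * x +_) (potential-updateAt-suc ws xs v)) (sym (+-assoc (w * x) _ _))

potential-updateAt-∸2 : ∀ {d} (w f : Vec ℕ d) u → 2 ≤ lookup f u →
  potential w (updateAt f u (λ x → x ∸ 2)) + 2 * lookup w u ≡ potential w f
potential-updateAt-∸2 (w ∷ ws) (suc (suc x) ∷ xs) zero _ = solved w x (potential ws xs)
  where
  solved : ∀ w x p → w * x + p + 2 * w ≡ w * suc (suc x) + p
  solved = solve-∀
potential-updateAt-∸2 (w ∷ ws) (suc zero ∷ xs) zero (s≤s ())
potential-updateAt-∸2 (w ∷ ws) (x ∷ xs) (suc u) 2≤fu =
  trans (+-assoc (w * x) _ _) (cong (w * x +_) (potential-updateAt-∸2 ws xs u 2≤fu))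

pebble≤potential : ∀ {d} (w f : Vec ℕ d) v → 1 ≤ lookup f v → lookup w v ≤ potential w f
pebble≤potential (w ∷ ws) (suc x ∷ xs) zero _ =
  ≤-trans (m≤m+n w (w * x)) (≤-trans (≤-reflexive (sym (*-suc w x))) (m≤m+n (w * suc x) _))
pebble≤potential (w ∷ ws) (x ∷ xs) (suc v) 1≤fv =
  ≤-trans (pebble≤potential ws xs v 1≤fv) (m≤n+m _ (w * x))

PebblingWeight : (G : Graph) → Vec ℕ (n G) → Set
PebblingWeight G w = ∀ {u v} → Adj G u v → lookup w v ≤ 2 * lookup w u

module _ {G : Graph} {w : Vec ℕ (n G)} (pebbling : PebblingWeight G w) where

  potential-Move : ∀ {f g} → Move G f g → potential w g ≤ potential w f
  potential-Move (move f u v u~v 2≤fu) = begin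
    potential w (updateAt f′ v suc)     ≡⟨ potential-updateAt-suc w f′ v ⟩
    potential w f′ + lookup w v         ≤⟨ +-monoʳ-≤ (potential w f′) (pebbling u~v) ⟩
    potential w f′ + 2 * lookup w u     ≡⟨ potential-updateAt-∸2 w f u 2≤fu ⟩
    potential w f                       ∎
    where
    open ≤-Reasoning
    f′ = updateAt f u (λ x → x ∸ 2)

  potential-Reach : ∀ {f g} → Reach G f g → potential w g ≤ potential w f
  potential-Reach ε              = ≤-refl
  potential-Reach (step ◅ steps) = ≤-trans (potential-Reach steps) (potential-Move step)

EdgeBalanced : ∀ {d} → Vec ℕ d → Fin d × Fin d → Set
EdgeBalanced w (a , b) = lookup w b ≤ 2 * lookup w a × lookup w a ≤ 2 * lookup w b

edgeBalanced? : ∀ {d} (w : Vec ℕ d) → Decidable (EdgeBalanced w)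
edgeBalanced? w (a , b) = lookup w b ≤? 2 * lookup w a ×-dec lookup w a ≤? 2 * lookup w b

edgeBalanced⇒pebblingWeight : ∀ {G w} → All (EdgeBalanced w) (edges G) → PebblingWeight G w
edgeBalanced⇒pebblingWeight balanced (inj₁ uv∈E) = proj₁ (All.lookup balanced uv∈E)
edgeBalanced⇒pebblingWeight balanced (inj₂ vu∈E) = proj₂ (All.lookup balanced vu∈E)

Feasible : ∀ {d} → (Fin d → Vec ℕ d) → Vec ℕ d → Set
Feasible W f = ∀ v → lookup (W v) v ≤ potential (W v) f

feasible? : ∀ {d} (W : Fin d → Vec ℕ d) → Decidable (Feasible W)
feasible? W f = all? (λ v → lookup (W v) v ≤? potential (W v) f)

solvable⇒feasible : ∀ {G W} → (∀ v → PebblingWeight G (W v)) →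
  ∀ {f} → Solvable G f → Feasible W f
solvable⇒feasible {W = W} pebbling {f} solvable v =
  let (g , f↝g , 1≤gv) = solvable v
  in ≤-trans (pebble≤potential (W v) g v 1≤gv) (potential-Reach {w = W v} (pebbling v) f↝g)

module _ {G : Graph} (W : Fin (n G) → Config G) (pebbling : ∀ v → PebblingWeight G (W v)) where

  isPi2Star : ∀ {m} f₀ → Optimal2 G m f₀ →
    (∀ f → TwoRestricted G f → Feasible W f → m ≤ weight G f) → IsPi2Star G m
  isPi2Star f₀ (solvable₀ , weight₀) lowerBound =
    (f₀ , solvable₀ , weight₀) ,
    λ f (restricted , solvable) → lowerBound f restricted (solvable⇒feasible {W = W} pebbling solvable)

  isP2Star : ∀ {m} (L : List (Config G)) → IsPi2Star G m → Unique L → All (Optimal2 G m) L →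
    (∀ f → TwoRestricted G f → Feasible W f → weight G f ≡ m → _∈_ {A = Config G} f L) →
    IsP2Star G m (length L)
  isP2Star L π unique optimal complete = π , L , unique , refl , λ f → mk⇔
    (All.lookup optimal)
    (λ ((restricted , solvable) , weight≡m) →
       complete f restricted (solvable⇒feasible {W = W} pebbling solvable) weight≡m)

boundedVecs : ℕ → (d : ℕ) → List (Vec ℕ d)
boundedVecs k zero    = [] ∷ []
boundedVecs k (suc d) = cartesianProductWith _∷_ (upTo (suc k)) (boundedVecs k d)

∈-boundedVecs : ∀ {k d} (f : Vec ℕ d) → (∀ i → lookup f i ≤ k) → f ∈ boundedVecs k d
∈-boundedVecs []       _       = here refl
∈-boundedVecs (x ∷ xs) bounded =
  ∈-cartesianProductWith⁺ _∷_ (∈-upTo⁺ (s≤s (bounded zero))) (∈-boundedVecs xs (λ i → bounded (suc i)))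

by-exhaustion : ∀ {k d} {P : Vec ℕ d → Set} (P? : Decidable P) →
  {True (All.all? P? (boundedVecs k d))} → ∀ f → (∀ i → lookup f i ≤ k) → P f
by-exhaustion P? {checked} f bounded = All.lookup (toWitness checked) (∈-boundedVecs f bounded)

adj? : (G : Graph) → ∀ u v → Dec (Adj G u v)
adj? G u v = ((u , v) ∈? edges G) ⊎-dec ((v , u) ∈? edges G)
  where open DecMembership (×-≡-dec _≟ᶠ_ _≟ᶠ_)

fire : ∀ {G} f u v → {True (adj? G u v)} → {True (2 ≤? lookup f u)} →
  Reach G f (updateAt (updateAt f u (λ x → x ∸ 2)) v suc)
fire f u v {u~v} {2≤fu} = move f u v (toWitness u~v) (toWitness 2≤fu) ◅ ε

reached : ∀ {G f g v} → Reach G f g → {True (1 ≤? lookup g v)} →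
  ∃ λ h → Reach G f h × 1 ≤ lookup h v
reached f↝g {1≤gv} = _ , f↝g , toWitness 1≤gv

twoRestricted? : (G : Graph) → Decidable (TwoRestricted G)
twoRestricted? G f = all? (λ u → lookup f u ≤? 2)

pattern v₀ = zero
pattern v₁ = suc v₀
pattern v₂ = suc v₁
pattern v₃ = suc v₂
pattern v₄ = suc v₃
pattern v₅ = suc v₄
pattern v₆ = suc v₅
pattern v₇ = suc v₆

module Methane where

  optimal : Config methane
  optimal = 2 ∷ 0 ∷ 0 ∷ 0 ∷ 0 ∷ []

  solvable : Solvable methane optimal
  solvable v₀ = reached ε
  solvable v₁ = reached (fire _ v₀ v₁)
  solvable v₂ = reached (fire _ v₀ v₂)
  solvable v₃ = reached (fire _ v₀ v₃)
  solvable v₄ = reached (fire _ v₀ v₄)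

  -- Row v is 2^(2 − d(v, ·)).
  weights : Fin 5 → Config methane
  weights v₀ = 4 ∷ 2 ∷ 2 ∷ 2 ∷ 2 ∷ []
  weights v₁ = 2 ∷ 4 ∷ 1 ∷ 1 ∷ 1 ∷ []
  weights v₂ = 2 ∷ 1 ∷ 4 ∷ 1 ∷ 1 ∷ []
  weights v₃ = 2 ∷ 1 ∷ 1 ∷ 4 ∷ 1 ∷ []
  weights v₄ = 2 ∷ 1 ∷ 1 ∷ 1 ∷ 4 ∷ []

  pebblingWeights : ∀ v → PebblingWeight methane (weights v)
  pebblingWeights v = edgeBalanced⇒pebblingWeight {w = weights v}
    (from-yes (all? (λ v → All.all? (edgeBalanced? (weights v)) (edges methane))) v)

  isOptimal : Optimal2 methane 2 optimal
  isOptimal = (from-yes (twoRestricted? methane optimal) , solvable) , refl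

  π₂* : IsPi2Star methane 2
  π₂* = isPi2Star weights pebblingWeights optimal isOptimal
    (by-exhaustion (λ f → feasible? weights f →-dec 2 ≤? sum f))

  P₂* : IsP2Star methane 2 1
  P₂* = isP2Star weights pebblingWeights (optimal ∷ []) π₂* ([] ∷ [])
    (isOptimal ∷ [])
    (by-exhaustion (λ f → feasible? weights f →-dec sum f ≟ 2 →-dec f ∈? (optimal ∷ [])))
    where open DecMembership (vec-≡-dec _≟_)

module Ethane where

  optimal₀ optimal₁ : Config ethane
  optimal₀ = 2 ∷ 1 ∷ 0 ∷ 0 ∷ 0 ∷ 0 ∷ 0 ∷ 0 ∷ []
  optimal₁ = 1 ∷ 2 ∷ 0 ∷ 0 ∷ 0 ∷ 0 ∷ 0 ∷ 0 ∷ []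

  solvable₀ : Solvable ethane optimal₀
  solvable₀ v₀ = reached ε
  solvable₀ v₁ = reached ε
  solvable₀ v₂ = reached (fire _ v₀ v₂)
  solvable₀ v₃ = reached (fire _ v₀ v₃)
  solvable₀ v₄ = reached (fire _ v₀ v₄)
  solvable₀ v₅ = reached (fire _ v₀ v₁ ◅◅ fire _ v₁ v₅)
  solvable₀ v₆ = reached (fire _ v₀ v₁ ◅◅ fire _ v₁ v₆)
  solvable₀ v₇ = reached (fire _ v₀ v₁ ◅◅ fire _ v₁ v₇)

  solvable₁ : Solvable ethane optimal₁
  solvable₁ v₀ = reached ε
  solvable₁ v₁ = reached ε
  solvable₁ v₂ = reached (fire _ v₁ v₀ ◅◅ fire _ v₀ v₂)
  solvable₁ v₃ = reached (fire _ v₁ v₀ ◅◅ fire _ v₀ v₃)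
  solvable₁ v₄ = reached (fire _ v₁ v₀ ◅◅ fire _ v₀ v₄)
  solvable₁ v₅ = reached (fire _ v₁ v₅)
  solvable₁ v₆ = reached (fire _ v₁ v₆)
  solvable₁ v₇ = reached (fire _ v₁ v₇)

  -- Row v is 2^(3 − d(v, ·)).
  weights : Fin 8 → Config ethane
  weights v₀ = 8 ∷ 4 ∷ 4 ∷ 4 ∷ 4 ∷ 2 ∷ 2 ∷ 2 ∷ []
  weights v₁ = 4 ∷ 8 ∷ 2 ∷ 2 ∷ 2 ∷ 4 ∷ 4 ∷ 4 ∷ []
  weights v₂ = 4 ∷ 2 ∷ 8 ∷ 2 ∷ 2 ∷ 1 ∷ 1 ∷ 1 ∷ []
  weights v₃ = 4 ∷ 2 ∷ 2 ∷ 8 ∷ 2 ∷ 1 ∷ 1 ∷ 1 ∷ []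
  weights v₄ = 4 ∷ 2 ∷ 2 ∷ 2 ∷ 8 ∷ 1 ∷ 1 ∷ 1 ∷ []
  weights v₅ = 2 ∷ 4 ∷ 1 ∷ 1 ∷ 1 ∷ 8 ∷ 2 ∷ 2 ∷ []
  weights v₆ = 2 ∷ 4 ∷ 1 ∷ 1 ∷ 1 ∷ 2 ∷ 8 ∷ 2 ∷ []
  weights v₇ = 2 ∷ 4 ∷ 1 ∷ 1 ∷ 1 ∷ 2 ∷ 2 ∷ 8 ∷ []

  pebblingWeights : ∀ v → PebblingWeight ethane (weights v)
  pebblingWeights v = edgeBalanced⇒pebblingWeight {w = weights v}
    (from-yes (all? (λ v → All.all? (edgeBalanced? (weights v)) (edges ethane))) v)

  isOptimal₀ : Optimal2 ethane 3 optimal₀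
  isOptimal₀ = (from-yes (twoRestricted? ethane optimal₀) , solvable₀) , refl

  isOptimal₁ : Optimal2 ethane 3 optimal₁
  isOptimal₁ = (from-yes (twoRestricted? ethane optimal₁) , solvable₁) , refl

  π₂* : IsPi2Star ethane 3
  π₂* = isPi2Star weights pebblingWeights optimal₀ isOptimal₀
    (by-exhaustion (λ f → feasible? weights f →-dec 3 ≤? sum f))

  optimal₀≢optimal₁ : optimal₀ ≢ optimal₁
  optimal₀≢optimal₁ ()

  P₂* : IsP2Star ethane 3 2
  P₂* = isP2Star weights pebblingWeights (optimal₀ ∷ optimal₁ ∷ []) π₂*
    ((optimal₀≢optimal₁ ∷ []) ∷ [] ∷ [])
    (isOptimal₀ ∷ isOptimal₁ ∷ [])
    (by-exhaustion (λ f → feasible? weights f →-dec sum f ≟ 3 →-dec f ∈? (optimal₀ ∷ optimal₁ ∷ [])))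
    where open DecMembership (vec-≡-dec _≟_)

mainTheorem5 : (IsPi2Star methane 2 × IsP2Star methane 2 1) × (IsPi2Star ethane 3 × IsP2Star ethane 3 2)
mainTheorem5 = (Methane.π₂* , Methane.P₂*) , (Ethane.π₂* , Ethane.P₂*)
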